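{- Let $d\geq 1$ and $n=2^d$. Then $\kappa(FDSC_n;K_{1,m})\leq \lfloor d/2\rfloor+1$ for every integer $m$ with $2\leq m\leq d+1$.
   Context: For $n=2^d$ ($d\ge 1$), the folded divide-and-swap cube $FDSC_n$ is the graph with vertex set $\{0,1\}^n$ (binary strings $u=s_1s_2\ldots s_n$). For $1\le k\le d$ write $u=m_1m_2m_3$ with $m_1=s_1\ldots s_{n/2^k}$, $m_2=s_{n/2^k+1}\ldots s_{n/2^{k-1}}$, $m_3=s_{n/2^{k-1}+1}\ldots s_n$ ($m_3$ empty when $k=1$). A vertex $v$ is adjacent to $u$ iff one of the following holds: (1) $v=\bar s_1s_2\ldots s_n$; (2) for some $1\le k\le d$, $v=\bar m_1\bar m_2m_3$ if $m_1=m_2$, and $v=m_2m_1m_3$ otherwise; (3) $v=s_1\bar s_2s_3\ldots s_n$. Here a bar denotes bitwise complement. For a graph $G$ and a connected graph $\mathcal H$, an $\mathcal H$-structure-cut is a set $\mathcal F=\{F_1,\dots,F_t\}$ of subgraphs of $G$, each isomorphic to $\mathcal H$, such that the subgraph of $G$ induced by $V(G)\setminus (V(F_1)\cup\dots\cup V(F_t))$ is disconnected or trivial (subgraphs need not be disjoint); $\kappa(G;\mathcal H)$ is the minimum cardinality of such a cut. $K_{1,m}$ is the star with one center and $m$ leaves. -}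

module Defs where

open import Data.Bool using (Bool; not)
open import Data.Bool.Properties using () renaming (_≟_ to _≟ᵇ_)
open import Data.Nat using (ℕ; suc; _^_; _∸_; _*_; _≤_)
open import Data.Fin using (Fin)
open import Data.List using (List; []; _∷_; _++_; take; drop; map)
open import Data.List.Properties using (≡-dec)
open import Data.List.Relation.Unary.Any using (Any)
open import Data.Vec using (Vec; toList)
open import Data.Product using (Σ; _×_; ∃)
open import Data.Sum using (_⊎_)
open import Relation.Nullary using (¬_; yes; no)
open import Relation.Binary.PropositionalEquality using (_≡_; _≢_)
open import Function.Definitions using (Injective)

Vertex : ℕ → Set
Vertex d = Vec Bool (2 ^ d)

flip₁ : List Bool → List Bool
flip₁ []       = []
flip₁ (x ∷ xs) = not x ∷ xs

flip₂ : List Bool → List Bool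
flip₂ []           = []
flip₂ (x ∷ [])     = x ∷ []
flip₂ (x ∷ y ∷ xs) = x ∷ not y ∷ xs

-- rule (2) for level k (1 ≤ k ≤ d): u = m₁ m₂ m₃ with |m₁| = |m₂| = n/2^k = 2^(d-k)
divSwap : (d k : ℕ) → List Bool → List Bool
divSwap d k u with ≡-dec _≟ᵇ_ m₁ m₂
  where
    b  = 2 ^ (d ∸ k)
    m₁ = take b u
    m₂ = take b (drop b u)
... | yes _ = map not m₁ ++ map not m₂ ++ m₃
  where
    b  = 2 ^ (d ∸ k)
    m₁ = take b u
    m₂ = take b (drop b u)
    m₃ = drop (2 * b) u
... | no _  = m₂ ++ m₁ ++ m₃
  where
    b  = 2 ^ (d ∸ k)
    m₁ = take b u
    m₂ = take b (drop b u)
    m₃ = drop (2 * b) u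

Adj : (d : ℕ) → Vertex d → Vertex d → Set
Adj d u v =
  (toList v ≡ flip₁ (toList u))
  ⊎ (Σ ℕ λ k → 1 ≤ k × k ≤ d × toList v ≡ divSwap d k (toList u))
  ⊎ (toList v ≡ flip₂ (toList u))

record Star (d m : ℕ) : Set where
  field
    center    : Vertex d
    leaf      : Fin m → Vertex d
    leaf-inj  : Injective _≡_ _≡_ leaf
    leaf≢ctr  : ∀ i → leaf i ≢ center
    leaf-adj  : ∀ i → Adj d center (leaf i)

InStar : (d : ℕ) → ∀ {m} → Star d m → Vertex d → Set
InStar d S v = (v ≡ Star.center S) ⊎ (Σ (Fin _) λ i → v ≡ Star.leaf S i)

Remaining : (d : ℕ) → ∀ {m} → List (Star d m) → Vertex d → Set
Remaining d F v = ¬ Any (λ S → InStar d S v) F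

data PathIn (d : ℕ) (R : Vertex d → Set) : Vertex d → Vertex d → Set where
  here : ∀ {u} → R u → PathIn d R u u
  step : ∀ {u w v} → R u → Adj d u w → PathIn d R w v → PathIn d R u v

Disconnected : (d : ℕ) → (Vertex d → Set) → Set
Disconnected d R = Σ (Vertex d) λ u → Σ (Vertex d) λ v →
  R u × R v × ¬ PathIn d R u v

Trivial : (d : ℕ) → (Vertex d → Set) → Set
Trivial d R = Σ (Vertex d) λ u → R u × (∀ v → R v → v ≡ u)

IsStructureCut : (d : ℕ) → ∀ {m} → List (Star d m) → Set
IsStructureCut d F = Disconnected d (Remaining d F) ⊎ Trivial d (Remaining d F)

{-# OPTIONS --safe #-}
-- Let u be the all-zero string. Its neighbours are 10…0, 010…0 and the prefixes 1^(2^j)0…0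
-- for 1 ≤ j ≤ d. The star centred at 010…0 contains 010…0, 10…0 and 110…0, and the star
-- centred at the indicator w_j of [2^j, 2^(j+1)) contains 1^(2^j)0…0 (swap its blocks of
-- length 2^j) and 1^(2^(j+1))0…0 (complement its blocks of length 2^(j-1)). The ⌊d/2⌋ centres
-- w_j with j = d-1, d-3, … therefore isolate u. For d = 1 nothing else survives. For d ≥ 2 the
-- string v with a single 1 at position 2^(d-1) survives as well: every move is an involution,
-- every neighbour of u or v begins with 1 while every centre begins with 0, so neither u nor v
-- is a leaf, and neither is a centre.
module Submission where

open import Defs
open import Data.Bool using (Bool; true; false; not; _∧_)
open import Data.Bool.Properties using (not-involutive; not-¬; ∧-zeroʳ) renaming (_≟_ to _≟ᵇ_)
open import Data.List using (List; []; _∷_; _++_; take; drop; map; length; applyUpTo)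
open import Data.List.Properties using (≡-dec; length-take; length-drop; length-map; length-++; length-applyUpTo)
open import Data.List.Relation.Unary.Any using (Any; here; there)
open import Data.List.Relation.Unary.Any.Properties using (applyUpTo⁺; applyUpTo⁻)
open import Data.Nat
open import Data.Nat.Properties
open import Data.Nat.DivMod using (m*n/n≡m; /-monoˡ-≤; m/n*n≤m)
open import Data.Product using (Σ; ∃; _×_; _,_; proj₂)
open import Data.Sum using (_⊎_; inj₁; inj₂)
open import Data.Fin using (Fin; toℕ; fromℕ<)
open import Data.Fin.Properties using (toℕ-injective; toℕ<n; toℕ-fromℕ<)
open import Data.Vec using (Vec; toList; fromList; _∷_; [])
open import Data.Vec.Properties using (toList-injective; toList∘fromList; cast-is-id)
open import Function using (_∘_)
open import Relation.Binary.PropositionalEquality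
open import Relation.Nullary using (¬_; yes; no; does; contradiction)
open import Relation.Nullary.Decidable using (dec-true; dec-false)
open import Relation.Binary.Definitions using (tri<; tri≈; tri>)

bit : List Bool → ℕ → Bool
bit []       _       = false
bit (x ∷ _)  zero    = x
bit (_ ∷ xs) (suc p) = bit xs p

bit-take : ∀ b xs {p} → p < b → bit (take b xs) p ≡ bit xs p
bit-take (suc b) []       _                 = refl
bit-take (suc b) (x ∷ xs) {zero}  _         = refl
bit-take (suc b) (x ∷ xs) {suc p} (s≤s p<b) = bit-take b xs p<b

bit-drop : ∀ b xs p → bit (drop b xs) p ≡ bit xs (b + p)
bit-drop zero    xs       p = refl
bit-drop (suc b) []       p = refl
bit-drop (suc b) (x ∷ xs) p = bit-drop b xs p

bit-++ˡ : ∀ xs ys {p} → p < length xs → bit (xs ++ ys) p ≡ bit xs p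
bit-++ˡ (x ∷ xs) ys {zero}  _         = refl
bit-++ˡ (x ∷ xs) ys {suc p} (s≤s p<n) = bit-++ˡ xs ys p<n

bit-++ʳ : ∀ xs ys p → bit (xs ++ ys) (length xs + p) ≡ bit ys p
bit-++ʳ []       ys p = refl
bit-++ʳ (x ∷ xs) ys p = bit-++ʳ xs ys p

bit-map-not : ∀ xs {p} → p < length xs → bit (map not xs) p ≡ not (bit xs p)
bit-map-not (x ∷ xs) {zero}  _         = refl
bit-map-not (x ∷ xs) {suc p} (s≤s p<n) = bit-map-not xs p<n

bit-applyUpTo : ∀ f n {p} → p < n → bit (applyUpTo f n) p ≡ f p
bit-applyUpTo f (suc n) {zero}  _         = refl
bit-applyUpTo f (suc n) {suc p} (s≤s p<n) = bit-applyUpTo (f ∘ suc) n p<n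

bit-ext : ∀ {xs ys} → length xs ≡ length ys →
          (∀ p → p < length xs → bit xs p ≡ bit ys p) → xs ≡ ys
bit-ext {[]}     {[]}     _  _    = refl
bit-ext {x ∷ xs} {y ∷ ys} eq same =
  cong₂ _∷_ (same 0 z<s) (bit-ext (suc-injective eq) (λ p → same (suc p) ∘ s≤s))

bit-extⁿ : ∀ {n xs ys} → length xs ≡ n → length ys ≡ n →
           (∀ p → p < n → bit xs p ≡ bit ys p) → xs ≡ ys
bit-extⁿ refl ∣ys∣ same = bit-ext (sym ∣ys∣) same

≢⇒bit-differs : ∀ xs ys → length xs ≡ length ys → xs ≢ ys →
                ∃ λ p → p < length xs × bit xs p ≢ bit ys p
≢⇒bit-differs []       []       _  xs≢ys = contradiction refl xs≢ys
≢⇒bit-differs (x ∷ xs) (y ∷ ys) eq xs≢ys with x ≟ᵇ y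
... | no x≢y   = 0 , z<s , x≢y
... | yes refl with ≢⇒bit-differs xs ys (suc-injective eq) (xs≢ys ∘ cong (x ∷_))
...   | p , p<n , differs = suc p , s≤s p<n , differs

bit-++₃-low : ∀ {b} A B C → length A ≡ b → ∀ {q} → q < b → bit (A ++ B ++ C) q ≡ bit A q
bit-++₃-low A B C refl = bit-++ˡ A (B ++ C)

bit-++₃-mid : ∀ {b} A B C → length A ≡ b → length B ≡ b → ∀ {q} → q < b →
              bit (A ++ B ++ C) (b + q) ≡ bit B q
bit-++₃-mid A B C refl ∣B∣≡b {q} q<b =
  trans (bit-++ʳ A (B ++ C) q) (bit-++ˡ B C (subst (q <_) (sym ∣B∣≡b) q<b))

bit-++₃-high : ∀ {b} A B C → length A ≡ b → length B ≡ b → ∀ r →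
               bit (A ++ B ++ C) (b + (b + r)) ≡ bit C r
bit-++₃-high A B C refl ∣B∣≡∣A∣ r = trans (bit-++ʳ A (B ++ C) _)
  (subst (λ k → bit (B ++ C) (k + r) ≡ bit C r) ∣B∣≡∣A∣ (bit-++ʳ B C r))

2*m≡m+m : ∀ m → 2 * m ≡ m + m
2*m≡m+m m = cong (m +_) (+-identityʳ m)

2*m+n≡m+[m+n] : ∀ m n → 2 * m + n ≡ m + (m + n)
2*m+n≡m+[m+n] m n = trans (cong (_+ n) (2*m≡m+m m)) (+-assoc m m n)

-- Swapping or complementing the first two blocks

data Region (b : ℕ) : ℕ → Set where
  first  : ∀ q → q < b → Region b q
  second : ∀ q → q < b → Region b (b + q)
  rest   : ∀ r → Region b (b + (b + r))

region : ∀ b p → Region b p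
region b p with p <? b
... | yes p<b = first p p<b
... | no p≮b with p ∸ b <? b
...   | yes p∸b<b = subst (Region b) (m+[n∸m]≡n (≮⇒≥ p≮b)) (second (p ∸ b) p∸b<b)
...   | no p∸b≮b  = subst (Region b)
          (trans (cong (b +_) (m+[n∸m]≡n (≮⇒≥ p∸b≮b))) (m+[n∸m]≡n (≮⇒≥ p≮b)))
          (rest (p ∸ b ∸ b))

swapBlocks : ℕ → List Bool → List Bool
swapBlocks b x = take b (drop b x) ++ take b x ++ drop (2 * b) x

complementBlocks : ℕ → List Bool → List Bool
complementBlocks b x = map not (take b x) ++ map not (take b (drop b x)) ++ drop (2 * b) x

blockOp : ℕ → List Bool → List Bool
blockOp b x with ≡-dec _≟ᵇ_ (take b x) (take b (drop b x))
... | yes _ = complementBlocks b x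
... | no  _ = swapBlocks b x

divSwap≡blockOp : ∀ d k x → divSwap d k x ≡ blockOp (2 ^ (d ∸ k)) x
divSwap≡blockOp d k x
  with ≡-dec _≟ᵇ_ (take (2 ^ (d ∸ k)) x) (take (2 ^ (d ∸ k)) (drop (2 ^ (d ∸ k)) x))
... | yes _ = refl
... | no  _ = refl

SameBlocks : ℕ → List Bool → Set
SameBlocks b x = ∀ q → q < b → bit x q ≡ bit x (b + q)

data BlockOpView (b : ℕ) (x : List Bool) : List Bool → Set where
  swapped      : ∀ q → q < b → bit x q ≢ bit x (b + q) → BlockOpView b x (swapBlocks b x)
  complemented : SameBlocks b x → BlockOpView b x (complementBlocks b x)

module _ (b : ℕ) (x : List Bool) (2b≤∣x∣ : 2 * b ≤ length x) where

  private
    block₁ block₂ block₃ : List Bool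
    block₁ = take b x
    block₂ = take b (drop b x)
    block₃ = drop (2 * b) x

    length-take≡ : ∀ {xs : List Bool} → b ≤ length xs → length (take b xs) ≡ b
    length-take≡ {xs} b≤ = trans (length-take b xs) (m≤n⇒m⊓n≡m b≤)

    length-block₁ : length block₁ ≡ b
    length-block₁ = length-take≡ (≤-trans (m≤m+n b _) 2b≤∣x∣)

    length-block₂ : length block₂ ≡ b
    length-block₂ = length-take≡ (begin
      b                   ≡⟨ m+n∸m≡n b b ⟨
      b + b ∸ b           ≤⟨ ∸-monoˡ-≤ b (subst (_≤ length x) (2*m≡m+m b) 2b≤∣x∣) ⟩
      length x ∸ b        ≡⟨ length-drop b x ⟨
      length (drop b x)   ∎)
      where open ≤-Reasoning

    length-¬block₁ : length (map not block₁) ≡ b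
    length-¬block₁ = trans (length-map not block₁) length-block₁

    length-¬block₂ : length (map not block₂) ≡ b
    length-¬block₂ = trans (length-map not block₂) length-block₂

    bit-block₂ : ∀ {q} → q < b → bit block₂ q ≡ bit x (b + q)
    bit-block₂ q<b = trans (bit-take b (drop b x) q<b) (bit-drop b x _)

    bit-block₃ : ∀ r → bit block₃ r ≡ bit x (b + (b + r))
    bit-block₃ r = trans (bit-drop (2 * b) x r) (cong (bit x) (2*m+n≡m+[m+n] b r))

    bit-¬block₁ : ∀ {q} → q < b → bit (map not block₁) q ≡ not (bit x q)
    bit-¬block₁ {q} q<b = trans (bit-map-not block₁ (subst (q <_) (sym length-block₁) q<b))
                                (cong not (bit-take b x q<b))

    bit-¬block₂ : ∀ {q} → q < b → bit (map not block₂) q ≡ not (bit x (b + q))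
    bit-¬block₂ {q} q<b = trans (bit-map-not block₂ (subst (q <_) (sym length-block₂) q<b))
                                (cong not (bit-block₂ q<b))

    length-blocks : ∀ A B → length A ≡ b → length B ≡ b → length (A ++ B ++ block₃) ≡ length x
    length-blocks A B ∣A∣ ∣B∣ = begin
      length (A ++ B ++ block₃)           ≡⟨ length-++ A ⟩
      length A + length (B ++ block₃)     ≡⟨ cong₂ _+_ ∣A∣ (trans (length-++ B) (cong (_+ _) ∣B∣)) ⟩
      b + (b + length block₃)             ≡⟨ 2*m+n≡m+[m+n] b _ ⟨
      2 * b + length block₃               ≡⟨ cong (2 * b +_) (length-drop (2 * b) x) ⟩
      2 * b + (length x ∸ 2 * b)          ≡⟨ m+[n∸m]≡n 2b≤∣x∣ ⟩
      length x                            ∎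
      where open ≡-Reasoning

  length-swapBlocks : length (swapBlocks b x) ≡ length x
  length-swapBlocks = length-blocks block₂ block₁ length-block₂ length-block₁

  length-complementBlocks : length (complementBlocks b x) ≡ length x
  length-complementBlocks = length-blocks (map not block₁) (map not block₂) length-¬block₁ length-¬block₂

  swapped-first : ∀ {q} → q < b → bit (swapBlocks b x) q ≡ bit x (b + q)
  swapped-first q<b = trans (bit-++₃-low block₂ block₁ block₃ length-block₂ q<b) (bit-block₂ q<b)

  swapped-second : ∀ {q} → q < b → bit (swapBlocks b x) (b + q) ≡ bit x q
  swapped-second q<b =
    trans (bit-++₃-mid block₂ block₁ block₃ length-block₂ length-block₁ q<b) (bit-take b x q<b)

  swapped-rest : ∀ r → bit (swapBlocks b x) (b + (b + r)) ≡ bit x (b + (b + r))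
  swapped-rest r =
    trans (bit-++₃-high block₂ block₁ block₃ length-block₂ length-block₁ r) (bit-block₃ r)

  complemented-first : ∀ {q} → q < b → bit (complementBlocks b x) q ≡ not (bit x q)
  complemented-first q<b =
    trans (bit-++₃-low (map not block₁) (map not block₂) block₃ length-¬block₁ q<b) (bit-¬block₁ q<b)

  complemented-second : ∀ {q} → q < b → bit (complementBlocks b x) (b + q) ≡ not (bit x (b + q))
  complemented-second q<b =
    trans (bit-++₃-mid (map not block₁) (map not block₂) block₃ length-¬block₁ length-¬block₂ q<b)
          (bit-¬block₂ q<b)

  complemented-rest : ∀ r → bit (complementBlocks b x) (b + (b + r)) ≡ bit x (b + (b + r))
  complemented-rest r =
    trans (bit-++₃-high (map not block₁) (map not block₂) block₃ length-¬block₁ length-¬block₂ r)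
          (bit-block₃ r)

  blockOp-view : BlockOpView b x (blockOp b x)
  blockOp-view with ≡-dec _≟ᵇ_ block₁ block₂
  ... | yes blocks≡ = complemented λ q q<b → begin
          bit x q        ≡⟨ bit-take b x q<b ⟨
          bit block₁ q   ≡⟨ cong (λ z → bit z q) blocks≡ ⟩
          bit block₂ q   ≡⟨ bit-block₂ q<b ⟩
          bit x (b + q)  ∎
    where open ≡-Reasoning
  ... | no blocks≢ with ≢⇒bit-differs block₁ block₂ (trans length-block₁ (sym length-block₂)) blocks≢
  ...   | q , q<∣block₁∣ , differs =
            let q<b = subst (q <_) length-block₁ q<∣block₁∣ in
            swapped q q<b λ eq → differs (trans (bit-take b x q<b) (trans eq (sym (bit-block₂ q<b))))

module _ (b : ℕ) (x : List Bool) (2b≤∣x∣ : 2 * b ≤ length x) where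

  blockOp-complements : SameBlocks b x → blockOp b x ≡ complementBlocks b x
  blockOp-complements same with blockOp b x | blockOp-view b x 2b≤∣x∣
  ... | _ | swapped q q<b differs = contradiction (same q q<b) differs
  ... | _ | complemented _        = refl

  blockOp-swaps : ∀ {q} → q < b → bit x q ≢ bit x (b + q) → blockOp b x ≡ swapBlocks b x
  blockOp-swaps q<b differs with blockOp b x | blockOp-view b x 2b≤∣x∣
  ... | _ | swapped _ _ _     = refl
  ... | _ | complemented same = contradiction (same _ q<b) differs

  length-blockOp : length (blockOp b x) ≡ length x
  length-blockOp with blockOp b x | blockOp-view b x 2b≤∣x∣
  ... | _ | swapped _ _ _  = length-swapBlocks b x 2b≤∣x∣
  ... | _ | complemented _ = length-complementBlocks b x 2b≤∣x∣

  blockOp-agrees-beyond : ∀ {p} → 2 * b ≤ p → bit (blockOp b x) p ≡ bit x p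
  blockOp-agrees-beyond {p} 2b≤p =
    subst (λ k → bit (blockOp b x) k ≡ bit x k) p≡b+[b+r] agrees
    where
      r = p ∸ 2 * b
      p≡b+[b+r] : b + (b + r) ≡ p
      p≡b+[b+r] = trans (sym (2*m+n≡m+[m+n] b r)) (m+[n∸m]≡n 2b≤p)
      agrees : bit (blockOp b x) (b + (b + r)) ≡ bit x (b + (b + r))
      agrees with blockOp b x | blockOp-view b x 2b≤∣x∣
      ... | _ | swapped _ _ _  = swapped-rest b x 2b≤∣x∣ r
      ... | _ | complemented _ = complemented-rest b x 2b≤∣x∣ r

  blockOp-changes : 1 ≤ b → ∃ λ p → b ≤ p × bit (blockOp b x) p ≢ bit x p
  blockOp-changes 1≤b with blockOp b x | blockOp-view b x 2b≤∣x∣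
  ... | _ | swapped q q<b differs =
    b + q , m≤m+n b q , λ eq → differs (trans (sym (swapped-second b x 2b≤∣x∣ q<b)) eq)
  ... | _ | complemented _ =
    b + 0 , m≤m+n b 0 , λ eq → not-¬ refl (trans (sym eq) (complemented-second b x 2b≤∣x∣ 1≤b))

module _ (b : ℕ) (x : List Bool) (2b≤∣x∣ : 2 * b ≤ length x) where

  private
    swapBlocks-involutive : swapBlocks b (swapBlocks b x) ≡ x
    swapBlocks-involutive =
      bit-ext (trans (length-swapBlocks b y 2b≤∣y∣) (length-swapBlocks b x 2b≤∣x∣))
        λ p _ → pointwise (region b p)
      where
        y = swapBlocks b x
        2b≤∣y∣ = subst (2 * b ≤_) (sym (length-swapBlocks b x 2b≤∣x∣)) 2b≤∣x∣
        pointwise : ∀ {p} → Region b p → bit (swapBlocks b y) p ≡ bit x p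
        pointwise (first q q<b)  = trans (swapped-first b y 2b≤∣y∣ q<b) (swapped-second b x 2b≤∣x∣ q<b)
        pointwise (second q q<b) = trans (swapped-second b y 2b≤∣y∣ q<b) (swapped-first b x 2b≤∣x∣ q<b)
        pointwise (rest r)       = trans (swapped-rest b y 2b≤∣y∣ r) (swapped-rest b x 2b≤∣x∣ r)

    complementBlocks-involutive : complementBlocks b (complementBlocks b x) ≡ x
    complementBlocks-involutive =
      bit-ext (trans (length-complementBlocks b y 2b≤∣y∣) (length-complementBlocks b x 2b≤∣x∣))
      λ p _ → pointwise (region b p)
      where
        y = complementBlocks b x
        2b≤∣y∣ = subst (2 * b ≤_) (sym (length-complementBlocks b x 2b≤∣x∣)) 2b≤∣x∣
        pointwise : ∀ {p} → Region b p → bit (complementBlocks b y) p ≡ bit x p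
        pointwise (first q q<b)  = trans (complemented-first b y 2b≤∣y∣ q<b)
          (trans (cong not (complemented-first b x 2b≤∣x∣ q<b)) (not-involutive _))
        pointwise (second q q<b) = trans (complemented-second b y 2b≤∣y∣ q<b)
          (trans (cong not (complemented-second b x 2b≤∣x∣ q<b)) (not-involutive _))
        pointwise (rest r)       =
          trans (complemented-rest b y 2b≤∣y∣ r) (complemented-rest b x 2b≤∣x∣ r)

  -- Swapping keeps the two blocks distinct and complementing keeps them equal,
  -- so the second application undoes the first.
  blockOp-involutive : blockOp b (blockOp b x) ≡ x
  blockOp-involutive with blockOp b x | blockOp-view b x 2b≤∣x∣
  ... | _ | swapped q q<b differs =
    trans (blockOp-swaps b y 2b≤∣y∣ q<b λ eq → differs (sym (begin
            bit x (b + q)      ≡⟨ swapped-first b x 2b≤∣x∣ q<b ⟨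
            bit y q            ≡⟨ eq ⟩
            bit y (b + q)      ≡⟨ swapped-second b x 2b≤∣x∣ q<b ⟩
            bit x q            ∎)))
          swapBlocks-involutive
    where
      open ≡-Reasoning
      y = swapBlocks b x
      2b≤∣y∣ = subst (2 * b ≤_) (sym (length-swapBlocks b x 2b≤∣x∣)) 2b≤∣x∣
  ... | _ | complemented same =
    trans (blockOp-complements b y 2b≤∣y∣ λ q q<b → begin
            bit y q                ≡⟨ complemented-first b x 2b≤∣x∣ q<b ⟩
            not (bit x q)          ≡⟨ cong not (same q q<b) ⟩
            not (bit x (b + q))    ≡⟨ complemented-second b x 2b≤∣x∣ q<b ⟨
            bit y (b + q)          ∎)
          complementBlocks-involutive
    where
      open ≡-Reasoning
      y = complementBlocks b x
      2b≤∣y∣ = subst (2 * b ≤_) (sym (length-complementBlocks b x 2b≤∣x∣)) 2b≤∣x∣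

-- Neighbours

length-flip₁ : ∀ x → length (flip₁ x) ≡ length x
length-flip₁ []      = refl
length-flip₁ (_ ∷ _) = refl

flip₁-involutive : ∀ x → flip₁ (flip₁ x) ≡ x
flip₁-involutive []       = refl
flip₁-involutive (b ∷ xs) = cong (_∷ xs) (not-involutive b)

bit-flip₁-zero : ∀ x → 1 ≤ length x → bit (flip₁ x) 0 ≡ not (bit x 0)
bit-flip₁-zero (_ ∷ _) _ = refl

bit-flip₁-suc : ∀ x p → bit (flip₁ x) (suc p) ≡ bit x (suc p)
bit-flip₁-suc []      _ = refl
bit-flip₁-suc (_ ∷ _) _ = refl

length-flip₂ : ∀ x → length (flip₂ x) ≡ length x
length-flip₂ []          = refl
length-flip₂ (_ ∷ [])    = refl
length-flip₂ (_ ∷ _ ∷ _) = refl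

bit-flip₂-zero : ∀ x → bit (flip₂ x) 0 ≡ bit x 0
bit-flip₂-zero []          = refl
bit-flip₂-zero (_ ∷ [])    = refl
bit-flip₂-zero (_ ∷ _ ∷ _) = refl

bit-flip₂-one : ∀ x → 2 ≤ length x → bit (flip₂ x) 1 ≡ not (bit x 1)
bit-flip₂-one (_ ∷ _ ∷ _) _           = refl
bit-flip₂-one (_ ∷ [])    (s≤s ())

bit-flip₂-from-2 : ∀ x p → bit (flip₂ x) (2 + p) ≡ bit x (2 + p)
bit-flip₂-from-2 []          _ = refl
bit-flip₂-from-2 (_ ∷ [])    _ = refl
bit-flip₂-from-2 (_ ∷ _ ∷ _) _ = refl

-- The neighbours used as leaves of stars: rule (1) for s = 0, and for s = e + 1
-- rule (2) at level k = d ∸ e, whose blocks have length 2 ^ e.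
neighbour : ℕ → List Bool → List Bool
neighbour zero    = flip₁
neighbour (suc e) = blockOp (2 ^ e)

vertex : ∀ {n} (xs : List Bool) → length xs ≡ n → Vec Bool n
vertex xs ∣xs∣ = subst (Vec Bool) ∣xs∣ (fromList xs)

toList-vertex : ∀ {n} xs (∣xs∣ : length xs ≡ n) → toList (vertex xs ∣xs∣) ≡ xs
toList-vertex xs ∣xs∣ = trans (toList-subst ∣xs∣ (fromList xs)) (toList∘fromList xs)
  where
    toList-subst : ∀ {m n} (eq : m ≡ n) (ys : Vec Bool m) → toList (subst (Vec Bool) eq ys) ≡ toList ys
    toList-subst refl _ = refl

≡-vertex : ∀ {n} {w : Vec Bool n} {xs} (∣xs∣ : length xs ≡ n) →
           toList w ≡ xs → w ≡ vertex xs ∣xs∣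
≡-vertex {w = w} {xs} ∣xs∣ eq = trans (sym (cast-is-id refl w))
  (toList-injective refl w (vertex xs ∣xs∣) (trans eq (sym (toList-vertex xs ∣xs∣))))

module _ {d : ℕ} {c : List Bool} (∣c∣ : length c ≡ 2 ^ d) where

  private
    blocks-fit : ∀ {e} → suc e ≤ d → 2 * 2 ^ e ≤ length c
    blocks-fit {e} 1+e≤d = subst (2 ^ suc e ≤_) (sym ∣c∣) (^-monoʳ-≤ 2 1+e≤d)

    nonempty : 1 ≤ length c
    nonempty = subst (1 ≤_) (sym ∣c∣) (m^n>0 2 d)

  length-neighbour : ∀ {s} → s ≤ d → length (neighbour s c) ≡ 2 ^ d
  length-neighbour {zero}  _     = trans (length-flip₁ c) ∣c∣
  length-neighbour {suc e} 1+e≤d = trans (length-blockOp (2 ^ e) c (blocks-fit 1+e≤d)) ∣c∣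

  neighbour-involutive : ∀ {s} → s ≤ d → neighbour s (neighbour s c) ≡ c
  neighbour-involutive {zero}  _     = flip₁-involutive c
  neighbour-involutive {suc e} 1+e≤d = blockOp-involutive (2 ^ e) c (blocks-fit 1+e≤d)

  neighbour-agrees-beyond : ∀ {s p} → s ≤ d → 2 ^ s ≤ p → bit (neighbour s c) p ≡ bit c p
  neighbour-agrees-beyond {zero}  {suc p} _     _   = bit-flip₁-suc c p
  neighbour-agrees-beyond {suc e}         1+e≤d 2b≤p =
    blockOp-agrees-beyond (2 ^ e) c (blocks-fit 1+e≤d) 2b≤p

  neighbour-≢ : ∀ {s} → s ≤ d → neighbour s c ≢ c
  neighbour-≢ {zero} _ eq =
    not-¬ refl (sym (trans (sym (bit-flip₁-zero c nonempty)) (cong (λ z → bit z 0) eq)))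
  neighbour-≢ {suc e} 1+e≤d eq with blockOp-changes (2 ^ e) c (blocks-fit 1+e≤d) (m^n>0 2 e)
  ... | p , _ , changed = changed (cong (λ z → bit z p) eq)

  private
    neighbour-≢-of-< : ∀ {s s'} → s < s' → s' ≤ d → neighbour s c ≢ neighbour s' c
    neighbour-≢-of-< {s} {suc e'} (s≤s s≤e') 1+e'≤d eq
      with blockOp-changes (2 ^ e') c (blocks-fit 1+e'≤d) (m^n>0 2 e')
    ... | p , 2^e'≤p , changed = changed (begin
      bit (neighbour (suc e') c) p   ≡⟨ cong (λ z → bit z p) eq ⟨
      bit (neighbour s c) p          ≡⟨ neighbour-agrees-beyond (≤-trans (m≤n⇒m≤1+n s≤e') 1+e'≤d)
                                          (≤-trans (^-monoʳ-≤ 2 s≤e') 2^e'≤p) ⟩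
      bit c p                        ∎)
      where open ≡-Reasoning

  neighbour-injective : ∀ {s s'} → s ≤ d → s' ≤ d → neighbour s c ≡ neighbour s' c → s ≡ s'
  neighbour-injective {s} {s'} s≤d s'≤d eq with <-cmp s s'
  ... | tri< s<s' _ _ = contradiction eq (neighbour-≢-of-< s<s' s'≤d)
  ... | tri≈ _ s≡s' _ = s≡s'
  ... | tri> _ _ s'<s = contradiction (sym eq) (neighbour-≢-of-< s'<s s≤d)

  neighbour-adjacent : ∀ {s} (s≤d : s ≤ d) →
                       Adj d (vertex c ∣c∣) (vertex (neighbour s c) (length-neighbour s≤d))
  neighbour-adjacent {zero} s≤d =
    inj₁ (trans (toList-vertex _ (length-neighbour s≤d)) (cong flip₁ (sym (toList-vertex c ∣c∣))))
  neighbour-adjacent {suc e} 1+e≤d = inj₂ (inj₁ (d ∸ e , m<n⇒0<n∸m 1+e≤d , m∸n≤m d e , (begin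
    toList (vertex (neighbour (suc e) c) _)   ≡⟨ toList-vertex _ (length-neighbour 1+e≤d) ⟩
    blockOp (2 ^ e) c                         ≡⟨ cong (λ k → blockOp (2 ^ k) c) d∸[d∸e]≡e ⟨
    blockOp (2 ^ (d ∸ (d ∸ e))) c             ≡⟨ divSwap≡blockOp d (d ∸ e) c ⟨
    divSwap d (d ∸ e) c                       ≡⟨ cong (divSwap d (d ∸ e)) (toList-vertex c ∣c∣) ⟨
    divSwap d (d ∸ e) (toList (vertex c ∣c∣)) ∎)))
    where
      open ≡-Reasoning
      d∸[d∸e]≡e = m∸[m∸n]≡n (<⇒≤ 1+e≤d)

-- Stars of neighbours

transpose : ℕ → ℕ → ℕ → ℕ
transpose a b t with t ≟ a
... | yes _ = b
... | no  _ with t ≟ b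
...   | yes _ = a
...   | no  _ = t

transpose-first : ∀ a b → transpose a b a ≡ b
transpose-first a b with a ≟ a
... | yes _   = refl
... | no  a≢a = contradiction refl a≢a

transpose-second : ∀ a b → transpose a b b ≡ a
transpose-second a b with b ≟ a
... | yes b≡a = b≡a
... | no  _ with b ≟ b
...   | yes _   = refl
...   | no  b≢b = contradiction refl b≢b

transpose-fixes : ∀ {a b t} → t ≢ a → t ≢ b → transpose a b t ≡ t
transpose-fixes {a} {b} {t} t≢a t≢b with t ≟ a
... | yes t≡a = contradiction t≡a t≢a
... | no  _ with t ≟ b
...   | yes t≡b = contradiction t≡b t≢b
...   | no  _   = refl

transpose-involutive : ∀ a b t → transpose a b (transpose a b t) ≡ t
transpose-involutive a b t with t ≟ a
... | yes refl = transpose-second t b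
... | no t≢a with t ≟ b
...   | yes refl = transpose-first a t
...   | no  t≢b  = transpose-fixes t≢a t≢b

transpose-injective : ∀ a b {t t'} → transpose a b t ≡ transpose a b t' → t ≡ t'
transpose-injective a b {t} {t'} eq = begin
  t                                     ≡⟨ transpose-involutive a b t ⟨
  transpose a b (transpose a b t)       ≡⟨ cong (transpose a b) eq ⟩
  transpose a b (transpose a b t')      ≡⟨ transpose-involutive a b t' ⟩
  t'                                    ∎
  where open ≡-Reasoning

transpose-≤ : ∀ {a b t n} → a ≤ n → b ≤ n → t ≤ n → transpose a b t ≤ n
transpose-≤ {a} {b} {t} a≤n b≤n t≤n with t ≟ a
... | yes _ = b≤n
... | no  _ with t ≟ b
...   | yes _ = a≤n
...   | no  _ = t≤n

-- A permutation of ℕ sending 0 to x and 1 to y when y ∉ {0, x}, so that the first two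
-- leaves of a star are the neighbours x and y of its centre.
leafIndex : ℕ → ℕ → ℕ → ℕ
leafIndex x y = transpose 0 x ∘ transpose 1 y

module NeighbourStar {d m : ℕ} (1≤d : 1 ≤ d) (m≤1+d : m ≤ suc d)
                     (c : List Bool) (∣c∣ : length c ≡ 2 ^ d)
                     (x y : ℕ) (x≤d : x ≤ d) (y≤d : y ≤ d) where

  index : Fin m → ℕ
  index i = leafIndex x y (toℕ i)

  index≤d : ∀ i → index i ≤ d
  index≤d i = transpose-≤ z≤n x≤d (transpose-≤ 1≤d y≤d (≤-pred (≤-trans (toℕ<n i) m≤1+d)))

  leaf : Fin m → Vertex d
  leaf i = vertex (neighbour (index i) c) (length-neighbour ∣c∣ (index≤d i))

  toList-leaf : ∀ i → toList (leaf i) ≡ neighbour (index i) c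
  toList-leaf i = toList-vertex _ (length-neighbour ∣c∣ (index≤d i))

  star : Star d m
  star = record
    { center   = vertex c ∣c∣
    ; leaf     = leaf
    ; leaf-inj = λ {i} {j} leaf≡ → toℕ-injective
        (transpose-injective 1 y (transpose-injective 0 x
          (neighbour-injective ∣c∣ (index≤d i) (index≤d j)
            (trans (sym (toList-leaf i)) (trans (cong toList leaf≡) (toList-leaf j))))))
    ; leaf≢ctr = λ i leaf≡ → neighbour-≢ ∣c∣ (index≤d i)
        (trans (sym (toList-leaf i)) (trans (cong toList leaf≡) (toList-vertex c ∣c∣)))
    ; leaf-adj = λ i → neighbour-adjacent ∣c∣ (index≤d i)
    }

  ∈-center : ∀ {w} → toList w ≡ c → InStar d star w
  ∈-center eq = inj₁ (≡-vertex ∣c∣ eq)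

  ∈-leaf : ∀ {w} i → toList w ≡ neighbour (index i) c → InStar d star w
  ∈-leaf i eq = inj₂ (i , ≡-vertex (length-neighbour ∣c∣ (index≤d i)) eq)

  ∈-leaf₀ : 1 ≤ m → y ≢ 0 → ∀ {w} → toList w ≡ neighbour x c → InStar d star w
  ∈-leaf₀ 1≤m y≢0 eq = ∈-leaf (fromℕ< 1≤m) (trans eq (cong (λ s → neighbour s c) (sym index₀)))
    where
      index₀ : index (fromℕ< 1≤m) ≡ x
      index₀ = begin
        leafIndex x y (toℕ (fromℕ< 1≤m))  ≡⟨ cong (leafIndex x y) (toℕ-fromℕ< 1≤m) ⟩
        transpose 0 x (transpose 1 y 0)   ≡⟨ cong (transpose 0 x) (transpose-fixes {1} (λ ()) (y≢0 ∘ sym)) ⟩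
        transpose 0 x 0                   ≡⟨ transpose-first 0 x ⟩
        x                                 ∎
        where open ≡-Reasoning

  ∈-leaf₁ : 2 ≤ m → y ≢ 0 → y ≢ x → ∀ {w} → toList w ≡ neighbour y c → InStar d star w
  ∈-leaf₁ 2≤m y≢0 y≢x eq =
    ∈-leaf (fromℕ< 2≤m) (trans eq (cong (λ s → neighbour s c) (sym index₁)))
    where
      index₁ : index (fromℕ< 2≤m) ≡ y
      index₁ = begin
        leafIndex x y (toℕ (fromℕ< 2≤m))  ≡⟨ cong (leafIndex x y) (toℕ-fromℕ< 2≤m) ⟩
        transpose 0 x (transpose 1 y 1)   ≡⟨ cong (transpose 0 x) (transpose-first 1 y) ⟩
        transpose 0 x y                   ≡⟨ transpose-fixes y≢0 y≢x ⟩
        y                                 ∎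
        where open ≡-Reasoning

  -- Every neighbour map is an involution, so z can only be a leaf if c is a neighbour of z.
  ∉-star : ∀ {z} → toList z ≢ c → bit c 0 ≡ false →
           (∀ s → s ≤ d → bit (neighbour s (toList z)) 0 ≡ true) → ¬ InStar d star z
  ∉-star z≢c _ _ (inj₁ z≡center) = z≢c (trans (cong toList z≡center) (toList-vertex c ∣c∣))
  ∉-star {z} _ c₀≡false starts-with-1 (inj₂ (i , z≡leaf)) = contradiction (begin
      true                                 ≡⟨ starts-with-1 s (index≤d i) ⟨
      bit (neighbour s (toList z)) 0       ≡⟨ cong (λ w → bit (neighbour s w) 0) z≡neighbour ⟩
      bit (neighbour s (neighbour s c)) 0  ≡⟨ cong (λ w → bit w 0) (neighbour-involutive ∣c∣ (index≤d i)) ⟩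
      bit c 0                              ≡⟨ c₀≡false ⟩
      false                                ∎) λ ()
    where
      open ≡-Reasoning
      s = index i
      z≡neighbour = trans (cong toList z≡leaf) (toList-leaf i)

-- Strings with a single run of ones

interval : ℕ → ℕ → ℕ → List Bool
interval n lo hi = applyUpTo (λ p → does (lo ≤? p) ∧ does (p <? hi)) n

module _ {n : ℕ} where

  length-interval : ∀ lo hi → length (interval n lo hi) ≡ n
  length-interval lo hi = length-applyUpTo _ n

  bit-interval-from : ∀ lo hi {p} → lo ≤ p → p < n → bit (interval n lo hi) p ≡ does (p <? hi)
  bit-interval-from lo hi {p} lo≤p p<n =
    trans (bit-applyUpTo _ n p<n) (cong (_∧ does (p <? hi)) (dec-true (lo ≤? p) lo≤p))

  bit-interval-below : ∀ lo hi {p} → p < lo → p < n → bit (interval n lo hi) p ≡ false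
  bit-interval-below lo hi {p} p<lo p<n =
    trans (bit-applyUpTo _ n p<n) (cong (_∧ does (p <? hi)) (dec-false (lo ≤? p) (<⇒≱ p<lo)))

  bit-interval-inside : ∀ lo hi {p} → lo ≤ p → p < hi → p < n → bit (interval n lo hi) p ≡ true
  bit-interval-inside lo hi {p} lo≤p p<hi p<n =
    trans (bit-interval-from lo hi lo≤p p<n) (dec-true (p <? hi) p<hi)

  bit-interval-above : ∀ lo hi {p} → hi ≤ p → p < n → bit (interval n lo hi) p ≡ false
  bit-interval-above lo hi {p} hi≤p p<n =
    trans (bit-applyUpTo _ n p<n)
      (trans (cong (does (lo ≤? p) ∧_) (dec-false (p <? hi) (≤⇒≯ hi≤p))) (∧-zeroʳ _))

  interval-empty : ∀ a → interval n a a ≡ interval n 0 0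
  interval-empty a = bit-extⁿ (length-interval a a) (length-interval 0 0) λ p p<n →
    trans (empty a p<n) (sym (empty 0 p<n))
    where
      empty : ∀ a {p} → p < n → bit (interval n a a) p ≡ false
      empty a {p} p<n with p <? a
      ... | yes p<a = bit-interval-below a a p<a p<n
      ... | no  p≮a = bit-interval-above a a (≮⇒≥ p≮a) p<n

  interval-empty≢ : ∀ {lo hi} → lo < hi → hi ≤ n → interval n 0 0 ≢ interval n lo hi
  interval-empty≢ {lo} {hi} lo<hi hi≤n eq = contradiction (begin
    false                      ≡⟨ bit-interval-above 0 0 z≤n lo<n ⟨
    bit (interval n 0 0) lo    ≡⟨ cong (λ z → bit z lo) eq ⟩
    bit (interval n lo hi) lo  ≡⟨ bit-interval-inside lo hi ≤-refl lo<hi lo<n ⟩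
    true                       ∎) λ ()
    where
      open ≡-Reasoning
      lo<n = <-≤-trans lo<hi hi≤n

  private
    ≢-at-lo : ∀ {lo hi lo' hi'} → lo < hi → hi ≤ n → lo < lo' →
              interval n lo hi ≢ interval n lo' hi'
    ≢-at-lo {lo} {hi} {lo'} {hi'} lo<hi hi≤n lo<lo' eq = contradiction
      (trans (sym (bit-interval-inside lo hi ≤-refl lo<hi lo<n)) (trans (cong (λ z → bit z lo) eq)
        (bit-interval-below lo' hi' lo<lo' lo<n))) λ ()
      where lo<n = <-≤-trans lo<hi hi≤n

    ≢-at-hi : ∀ {lo hi hi'} → lo ≤ hi → hi < hi' → hi' ≤ n →
              interval n lo hi ≢ interval n lo hi'
    ≢-at-hi {lo} {hi} {hi'} lo≤hi hi<hi' hi'≤n eq = contradiction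
      (trans (sym (bit-interval-inside lo hi' lo≤hi hi<hi' hi<n)) (trans (cong (λ z → bit z hi) (sym eq))
        (bit-interval-above lo hi ≤-refl hi<n))) λ ()
      where hi<n = <-≤-trans hi<hi' hi'≤n

  interval-injective : ∀ {lo hi lo' hi'} → lo < hi → hi ≤ n → lo' < hi' → hi' ≤ n →
                       interval n lo hi ≡ interval n lo' hi' → lo ≡ lo' × hi ≡ hi'
  interval-injective {lo} {hi} {lo'} {hi'} lo<hi hi≤n lo'<hi' hi'≤n eq with <-cmp lo lo'
  ... | tri< lo<lo' _ _ = contradiction eq (≢-at-lo {hi' = hi'} lo<hi hi≤n lo<lo')
  ... | tri> _ _ lo'<lo = contradiction (sym eq) (≢-at-lo {hi' = hi} lo'<hi' hi'≤n lo'<lo)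
  ... | tri≈ _ refl _ with <-cmp hi hi'
  ...   | tri< hi<hi' _ _ = contradiction eq (≢-at-hi (<⇒≤ lo<hi) hi<hi' hi'≤n)
  ...   | tri≈ _ hi≡hi' _ = refl , hi≡hi'
  ...   | tri> _ _ hi'<hi = contradiction (sym eq) (≢-at-hi (<⇒≤ lo'<hi') hi'<hi hi≤n)

  flip₁-interval : ∀ hi → 1 ≤ hi → 1 ≤ n → flip₁ (interval n 1 hi) ≡ interval n 0 hi
  flip₁-interval hi 1≤hi 1≤n =
    bit-extⁿ (trans (length-flip₁ x) (length-interval 1 hi)) (length-interval 0 hi) pointwise
    where
      open ≡-Reasoning
      x = interval n 1 hi
      ∣x∣ = length-interval 1 hi
      pointwise : ∀ p → p < n → bit (flip₁ x) p ≡ bit (interval n 0 hi) p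
      pointwise zero _ = begin
        bit (flip₁ x) 0                ≡⟨ bit-flip₁-zero x (≤-trans 1≤n (≤-reflexive (sym ∣x∣))) ⟩
        not (bit x 0)                  ≡⟨ cong not (bit-interval-below 1 hi z<s 1≤n) ⟩
        true                           ≡⟨ bit-interval-inside 0 hi z≤n 1≤hi 1≤n ⟨
        bit (interval n 0 hi) 0        ∎
      pointwise (suc p) 1+p<n = begin
        bit (flip₁ x) (suc p)          ≡⟨ bit-flip₁-suc x p ⟩
        bit x (suc p)                  ≡⟨ bit-interval-from 1 hi (s≤s z≤n) 1+p<n ⟩
        does (suc p <? hi)             ≡⟨ bit-interval-from 0 hi z≤n 1+p<n ⟨
        bit (interval n 0 hi) (suc p)  ∎

  flip₂-interval : ∀ hi → 2 ≤ hi → 2 ≤ n → flip₂ (interval n 2 hi) ≡ interval n 1 hi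
  flip₂-interval hi 2≤hi 2≤n =
    bit-extⁿ (trans (length-flip₂ x) (length-interval 2 hi)) (length-interval 1 hi) pointwise
    where
      open ≡-Reasoning
      x = interval n 2 hi
      ∣x∣ = length-interval 2 hi
      pointwise : ∀ p → p < n → bit (flip₂ x) p ≡ bit (interval n 1 hi) p
      pointwise zero 0<n = begin
        bit (flip₂ x) 0                ≡⟨ bit-flip₂-zero x ⟩
        bit x 0                        ≡⟨ bit-interval-below 2 hi z<s 0<n ⟩
        false                          ≡⟨ bit-interval-below 1 hi z<s 0<n ⟨
        bit (interval n 1 hi) 0        ∎
      pointwise (suc zero) 1<n = begin
        bit (flip₂ x) 1                ≡⟨ bit-flip₂-one x (≤-trans 2≤n (≤-reflexive (sym ∣x∣))) ⟩
        not (bit x 1)                  ≡⟨ cong not (bit-interval-below 2 hi ≤-refl 1<n) ⟩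
        true                           ≡⟨ bit-interval-inside 1 hi ≤-refl 2≤hi 1<n ⟨
        bit (interval n 1 hi) 1        ∎
      pointwise (suc (suc p)) 2+p<n = begin
        bit (flip₂ x) (2 + p)          ≡⟨ bit-flip₂-from-2 x p ⟩
        bit x (2 + p)                  ≡⟨ bit-interval-from 2 hi (s≤s (s≤s z≤n)) 2+p<n ⟩
        does (2 + p <? hi)             ≡⟨ bit-interval-from 1 hi (s≤s z≤n) 2+p<n ⟨
        bit (interval n 1 hi) (2 + p)  ∎

  private
    second<2b : ∀ {b q} → q < b → b + q < 2 * b
    second<2b {b} {q} q<b = subst (b + q <_) (sym (2*m≡m+m b)) (+-monoʳ-< b q<b)

    first<2b : ∀ {b q} → q < b → q < 2 * b
    first<2b {b} q<b = <-≤-trans q<b (m≤m+n b _)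

    2b≤rest : ∀ b r → 2 * b ≤ b + (b + r)
    2b≤rest b r = ≤-trans (m≤m+n (2 * b) r) (≤-reflexive (2*m+n≡m+[m+n] b r))

  interval-SameBlocks : ∀ b lo hi → 2 * b ≤ lo → 2 * b ≤ n → SameBlocks b (interval n lo hi)
  interval-SameBlocks b lo hi 2b≤lo 2b≤n q q<b = trans
    (bit-interval-below lo hi (<-≤-trans (first<2b q<b) 2b≤lo) (<-≤-trans (first<2b q<b) 2b≤n))
    (sym (bit-interval-below lo hi (<-≤-trans (second<2b q<b) 2b≤lo) (<-≤-trans (second<2b q<b) 2b≤n)))

  -- Blocks 0^b and 1^b differ, so they are swapped.
  blockOp-interval-swap : ∀ b → 1 ≤ b → 2 * b ≤ n → blockOp b (interval n b (2 * b)) ≡ interval n 0 b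
  blockOp-interval-swap b 1≤b 2b≤n = begin
    blockOp b x       ≡⟨ blockOp-swaps b x 2b≤∣x∣ 1≤b block₁≢block₂ ⟩
    swapBlocks b x    ≡⟨ bit-extⁿ (trans (length-swapBlocks b x 2b≤∣x∣) (length-interval b (2 * b)))
                           (length-interval 0 b) (λ p → pointwise (region b p)) ⟩
    interval n 0 b    ∎
    where
      open ≡-Reasoning
      x = interval n b (2 * b)
      2b≤∣x∣ = subst (2 * b ≤_) (sym (length-interval b (2 * b))) 2b≤n
      second-inside : ∀ {q} → q < b → bit x (b + q) ≡ true
      second-inside q<b =
        bit-interval-inside b (2 * b) (m≤m+n b _) (second<2b q<b) (<-≤-trans (second<2b q<b) 2b≤n)
      first-outside : ∀ {q} → q < b → bit x q ≡ false
      first-outside q<b = bit-interval-below b (2 * b) q<b (<-≤-trans (first<2b q<b) 2b≤n)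
      block₁≢block₂ : bit x 0 ≢ bit x (b + 0)
      block₁≢block₂ eq =
        contradiction (trans (sym (first-outside 1≤b)) (trans eq (second-inside 1≤b))) λ ()
      pointwise : ∀ {p} → Region b p → p < n → bit (swapBlocks b x) p ≡ bit (interval n 0 b) p
      pointwise (first q q<b) q<n = begin
        bit (swapBlocks b x) q               ≡⟨ swapped-first b x 2b≤∣x∣ q<b ⟩
        bit x (b + q)                        ≡⟨ second-inside q<b ⟩
        true                                 ≡⟨ bit-interval-inside 0 b z≤n q<b q<n ⟨
        bit (interval n 0 b) q               ∎
      pointwise (second q q<b) b+q<n = begin
        bit (swapBlocks b x) (b + q)         ≡⟨ swapped-second b x 2b≤∣x∣ q<b ⟩
        bit x q                              ≡⟨ first-outside q<b ⟩
        false                                ≡⟨ bit-interval-above 0 b (m≤m+n b q) b+q<n ⟨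
        bit (interval n 0 b) (b + q)         ∎
      pointwise (rest r) p<n = begin
        bit (swapBlocks b x) (b + (b + r))   ≡⟨ swapped-rest b x 2b≤∣x∣ r ⟩
        bit x (b + (b + r))                  ≡⟨ bit-interval-above b (2 * b) (2b≤rest b r) p<n ⟩
        false                                ≡⟨ bit-interval-above 0 b (m≤m+n b (b + r)) p<n ⟨
        bit (interval n 0 b) (b + (b + r))   ∎

  -- Both blocks are 0^b, so they are complemented.
  blockOp-interval-complement : ∀ b hi → 2 * b ≤ hi → 2 * b ≤ n →
                                blockOp b (interval n (2 * b) hi) ≡ interval n 0 hi
  blockOp-interval-complement b hi 2b≤hi 2b≤n = begin
    blockOp b x            ≡⟨ blockOp-complements b x 2b≤∣x∣
                                (interval-SameBlocks b (2 * b) hi ≤-refl 2b≤n) ⟩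
    complementBlocks b x   ≡⟨ bit-extⁿ (trans (length-complementBlocks b x 2b≤∣x∣)
                                (length-interval (2 * b) hi)) (length-interval 0 hi)
                                (λ p → pointwise (region b p)) ⟩
    interval n 0 hi        ∎
    where
      open ≡-Reasoning
      x = interval n (2 * b) hi
      2b≤∣x∣ = subst (2 * b ≤_) (sym (length-interval (2 * b) hi)) 2b≤n
      pointwise : ∀ {p} → Region b p → p < n → bit (complementBlocks b x) p ≡ bit (interval n 0 hi) p
      below-2b : ∀ {p} → p < 2 * b → p < n → bit (complementBlocks b x) p ≡ not (bit x p) →
                 bit (complementBlocks b x) p ≡ bit (interval n 0 hi) p
      below-2b {p} p<2b p<n complemented-bit = begin
        bit (complementBlocks b x) p   ≡⟨ complemented-bit ⟩
        not (bit x p)                  ≡⟨ cong not (bit-interval-below (2 * b) hi p<2b p<n) ⟩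
        true                           ≡⟨ bit-interval-inside 0 hi z≤n (<-≤-trans p<2b 2b≤hi) p<n ⟨
        bit (interval n 0 hi) p        ∎
      pointwise (first q q<b) q<n =
        below-2b (first<2b q<b) q<n (complemented-first b x 2b≤∣x∣ q<b)
      pointwise (second q q<b) b+q<n =
        below-2b (second<2b q<b) b+q<n (complemented-second b x 2b≤∣x∣ q<b)
      pointwise (rest r) p<n = begin
        bit (complementBlocks b x) (b + (b + r))   ≡⟨ complemented-rest b x 2b≤∣x∣ r ⟩
        bit x (b + (b + r))                        ≡⟨ bit-interval-from (2 * b) hi (2b≤rest b r) p<n ⟩
        does (b + (b + r) <? hi)                   ≡⟨ bit-interval-from 0 hi z≤n p<n ⟨
        bit (interval n 0 hi) (b + (b + r))        ∎

-- The cut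

path-from-isolated : ∀ {d} {R : Vertex d → Set} {u w} →
                     (∀ {w} → Adj d u w → ¬ R w) → PathIn d R u w → w ≡ u
path-from-isolated _        (here _)         = refl
path-from-isolated isolated (step _ adj path) = contradiction (start path) (isolated adj)
  where
    start : ∀ {d} {R : Vertex d → Set} {a b} → PathIn d R a b → R a
    start (here r)     = r
    start (step r _ _) = r

2*k≤d⇒k≤d/2 : ∀ k d → 2 * k ≤ d → k ≤ d / 2
2*k≤d⇒k≤d/2 k d 2k≤d =
  subst (_≤ d / 2) (m*n/n≡m k 2) (/-monoˡ-≤ 2 (subst (_≤ d) (*-comm 2 k) 2k≤d))

k≤d/2⇒2*k≤d : ∀ k d → k ≤ d / 2 → 2 * k ≤ d
k≤d/2⇒2*k≤d k d k≤d/2 =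
  ≤-trans (subst (2 * k ≤_) (*-comm 2 (d / 2)) (*-monoʳ-≤ 2 k≤d/2)) (m/n*n≤m d 2)

even-or-odd : ∀ g → ∃ λ t → g ≡ 2 * t ⊎ g ≡ suc (2 * t)
even-or-odd zero = 0 , inj₁ refl
even-or-odd (suc g) with even-or-odd g
... | t , inj₁ g≡2t  = t , inj₂ (cong suc g≡2t)
... | t , inj₂ g≡2t+1 = suc t , inj₁ (trans (cong suc g≡2t+1) (sym (*-suc 2 t)))

2^-even : ∀ k → 1 ≤ k → ∃ λ a → 2 ^ k ≡ 2 * a
2^-even (suc k) _ = 2 ^ k , refl

module Cut (e m : ℕ) (2≤m : 2 ≤ m) (m≤1+d : m ≤ suc (suc e)) where

  d : ℕ
  d = suc e

  n : ℕ
  n = 2 ^ d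

  private
    1≤d : 1 ≤ d
    1≤d = s≤s z≤n

    1≤m : 1 ≤ m
    1≤m = ≤-trans (s≤s z≤n) 2≤m

    0<n : 0 < n
    0<n = m^n>0 2 d

    2^-≤n : ∀ {k} → k ≤ d → 2 ^ k ≤ n
    2^-≤n = ^-monoʳ-≤ 2

    2^-<2^suc : ∀ k → 2 ^ k < 2 ^ suc k
    2^-<2^suc k = ^-monoʳ-< 2 (s≤s (s≤s z≤n)) (n<1+n k)

  zeros : List Bool
  zeros = interval n 0 0

  u : Vertex d
  u = vertex zeros (length-interval 0 0)

  toList-u : toList u ≡ zeros
  toList-u = toList-vertex zeros (length-interval 0 0)

  module B = NeighbourStar 1≤d m≤1+d (interval n 1 2) (length-interval 1 2) 0 1 z≤n 1≤d

  W-centre : ℕ → List Bool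
  W-centre j = interval n (2 ^ j) (2 ^ suc j)

  level : ℕ → ℕ
  level t = e ∸ 2 * t

  level<d : ∀ t → level t < d
  level<d t = s≤s (m∸n≤m e (2 * t))

  module W (t : ℕ) = NeighbourStar 1≤d m≤1+d
    (W-centre (level t)) (length-interval (2 ^ level t) (2 ^ suc (level t)))
    (suc (level t)) (level t) (level<d t) (<⇒≤ (level<d t))

  cutStars : List (Star d m)
  cutStars = B.star ∷ applyUpTo W.star (d / 2)

  length-cutStars : length cutStars ≤ d / 2 + 1
  length-cutStars = ≤-reflexive (trans (cong suc (length-applyUpTo W.star (d / 2))) (+-comm 1 (d / 2)))

  1≤level : ∀ {t} → t < d / 2 → 1 ≤ level t
  1≤level {t} t<d/2 = m<n⇒0<n∸m (≤-pred (subst (_≤ d) (*-suc 2 t) (k≤d/2⇒2*k≤d (suc t) d t<d/2)))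

  level-covers : ∀ E → 1 ≤ E → E ≤ e → ∃ λ t → t < d / 2 × (level t ≡ E ⊎ level t ≡ suc E)
  level-covers E 1≤E E≤e with even-or-odd (e ∸ E)
  ... | t , parity = t , 2*k≤d⇒k≤d/2 (suc t) d 2[1+t]≤d , level≡ parity
    where
      e≡E+[e∸E] : e ≡ E + (e ∸ E)
      e≡E+[e∸E] = sym (m+[n∸m]≡n E≤e)

      2t≤ : e ∸ E ≡ 2 * t ⊎ e ∸ E ≡ suc (2 * t) → 2 * t ≤ e ∸ E
      2t≤ (inj₁ even) = ≤-reflexive (sym even)
      2t≤ (inj₂ odd)  = ≤-trans (n≤1+n _) (≤-reflexive (sym odd))

      2[1+t]≤d : 2 * suc t ≤ d
      2[1+t]≤d = subst (_≤ d) (sym (*-suc 2 t)) (s≤s (begin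
        suc (2 * t)    ≤⟨ +-monoˡ-≤ (2 * t) 1≤E ⟩
        E + 2 * t      ≤⟨ +-monoʳ-≤ E (2t≤ parity) ⟩
        E + (e ∸ E)    ≡⟨ e≡E+[e∸E] ⟨
        e              ∎))
        where open ≤-Reasoning

      level≡ : e ∸ E ≡ 2 * t ⊎ e ∸ E ≡ suc (2 * t) → level t ≡ E ⊎ level t ≡ suc E
      level≡ (inj₁ even) = inj₁ (begin
        e ∸ 2 * t                ≡⟨ cong (_∸ 2 * t) (trans e≡E+[e∸E] (cong (E +_) even)) ⟩
        E + 2 * t ∸ 2 * t        ≡⟨ m+n∸n≡m E (2 * t) ⟩
        E                        ∎)
        where open ≡-Reasoning
      level≡ (inj₂ odd)  = inj₂ (begin
        e ∸ 2 * t                ≡⟨ cong (_∸ 2 * t) (trans e≡E+[e∸E] (cong (E +_) odd)) ⟩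
        E + suc (2 * t) ∸ 2 * t  ≡⟨ cong (_∸ 2 * t) (+-suc E (2 * t)) ⟩
        suc E + 2 * t ∸ 2 * t    ≡⟨ m+n∸n≡m (suc E) (2 * t) ⟩
        suc E                    ∎)
        where open ≡-Reasoning

  neighbour-swaps-W-centre : ∀ j → j < d → neighbour (suc j) (W-centre j) ≡ interval n 0 (2 ^ j)
  neighbour-swaps-W-centre j j<d = blockOp-interval-swap (2 ^ j) (m^n>0 2 j) (2^-≤n j<d)

  neighbour-complements-W-centre : ∀ j → 1 ≤ j → j < d →
                                   neighbour j (W-centre j) ≡ interval n 0 (2 ^ suc j)
  neighbour-complements-W-centre (suc j) _ 1+j<d = blockOp-interval-complement (2 ^ j) (2 ^ suc (suc j))
    (^-monoʳ-≤ 2 (n≤1+n (suc j))) (2^-≤n (<⇒≤ 1+j<d))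

  prefix-covered : ∀ E → E < d → ∀ {w} → toList w ≡ interval n 0 (2 ^ suc E) →
                   Any (λ S → InStar d S w) cutStars
  prefix-covered zero _ w≡ =
    here (B.∈-leaf₀ 1≤m (λ ()) (trans w≡ (sym (flip₁-interval 2 (s≤s z≤n) 0<n))))
  prefix-covered (suc E) 1+E<d w≡ with level-covers (suc E) (s≤s z≤n) (≤-pred 1+E<d)
  ... | t , t<d/2 , inj₁ level≡1+E =
    there (applyUpTo⁺ W.star (W.∈-leaf₁ t 2≤m level≢0 (<⇒≢ (n<1+n _))
        (trans w≡ (trans (cong (λ j → interval n 0 (2 ^ suc j)) (sym level≡1+E))
          (sym (neighbour-complements-W-centre (level t) (1≤level t<d/2) (level<d t)))))) t<d/2)
    where level≢0 = >⇒≢ (1≤level t<d/2)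
  ... | t , t<d/2 , inj₂ level≡2+E =
    there (applyUpTo⁺ W.star (W.∈-leaf₀ t 1≤m level≢0
        (trans w≡ (trans (cong (λ j → interval n 0 (2 ^ j)) (sym level≡2+E))
          (sym (neighbour-swaps-W-centre (level t) (level<d t)))))) t<d/2)
    where level≢0 = >⇒≢ (1≤level t<d/2)

  flip₁-zeros : flip₁ zeros ≡ interval n 0 1
  flip₁-zeros = trans (cong flip₁ (sym (interval-empty 1))) (flip₁-interval 1 ≤-refl 0<n)

  flip₂-zeros : flip₂ zeros ≡ interval n 1 2
  flip₂-zeros = trans (cong flip₂ (sym (interval-empty 2))) (flip₂-interval 2 ≤-refl (2^-≤n 1≤d))

  blockOp-zeros : ∀ b → 2 * b ≤ n → blockOp b zeros ≡ interval n 0 (2 * b)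
  blockOp-zeros b 2b≤n =
    trans (cong (blockOp b) (sym (interval-empty (2 * b)))) (blockOp-interval-complement b (2 * b) ≤-refl 2b≤n)

  neighbours-of-u-covered : ∀ {w} → Adj d u w → Any (λ S → InStar d S w) cutStars
  neighbours-of-u-covered (inj₁ w≡flip₁) = here (B.∈-leaf₁ 2≤m (λ ()) (λ ())
    (trans w≡flip₁ (trans (cong flip₁ toList-u) (trans flip₁-zeros
      (sym (blockOp-interval-swap 1 ≤-refl (2^-≤n 1≤d)))))))
  neighbours-of-u-covered (inj₂ (inj₂ w≡flip₂)) =
    here (B.∈-center (trans w≡flip₂ (trans (cong flip₂ toList-u) flip₂-zeros)))
  neighbours-of-u-covered (inj₂ (inj₁ (suc k , _ , _ , w≡divSwap))) = prefix-covered (e ∸ k) d∸k<d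
    (trans w≡divSwap (trans (cong (divSwap d (suc k)) toList-u)
      (trans (divSwap≡blockOp d (suc k) zeros) (blockOp-zeros (2 ^ (e ∸ k)) (2^-≤n d∸k<d)))))
    where d∸k<d = s≤s (m∸n≤m e k)

  remains : ∀ {z} → ¬ InStar d B.star z → (∀ t → t < d / 2 → ¬ InStar d (W.star t) z) →
            Remaining d cutStars z
  remains ∉B _   (here z∈B)  = ∉B z∈B
  remains _  ∉W (there z∈W) with applyUpTo⁻ W.star z∈W
  ... | t , t<d/2 , z∈Wt = ∉W t t<d/2 z∈Wt

  B-centre-starts-with-0 : bit (interval n 1 2) 0 ≡ false
  B-centre-starts-with-0 = bit-interval-below 1 2 z<s 0<n

  W-centre-starts-with-0 : ∀ j → bit (W-centre j) 0 ≡ false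
  W-centre-starts-with-0 j = bit-interval-below (2 ^ j) (2 ^ suc j) (m^n>0 2 j) 0<n

  zeros-neighbours-start-with-1 : ∀ s → s ≤ d → bit (neighbour s zeros) 0 ≡ true
  zeros-neighbours-start-with-1 zero    _     =
    trans (cong (λ z → bit z 0) flip₁-zeros) (bit-interval-inside 0 1 z≤n z<s 0<n)
  zeros-neighbours-start-with-1 (suc s) 1+s≤d =
    trans (cong (λ z → bit z 0) (blockOp-zeros (2 ^ s) (2^-≤n 1+s≤d)))
      (bit-interval-inside 0 (2 ^ suc s) z≤n (m^n>0 2 (suc s)) 0<n)

  u-remains : Remaining d cutStars u
  u-remains = remains
    (B.∉-star (u≢ (interval-empty≢ (s≤s ≤-refl) (2^-≤n 1≤d))) B-centre-starts-with-0 u-neighbours)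
    λ t _ → W.∉-star t (u≢ (interval-empty≢ (2^-<2^suc (level t)) (2^-≤n (level<d t))))
                  (W-centre-starts-with-0 (level t)) u-neighbours
    where
      u≢ : ∀ {c} → zeros ≢ c → toList u ≢ c
      u≢ zeros≢c = zeros≢c ∘ trans (sym toList-u)
      u-neighbours : ∀ s → s ≤ d → bit (neighbour s (toList u)) 0 ≡ true
      u-neighbours s s≤d =
        trans (cong (λ z → bit (neighbour s z) 0) toList-u) (zeros-neighbours-start-with-1 s s≤d)

  module _ (1≤e : 1 ≤ e) where

    h : ℕ
    h = 2 ^ e

    private
      1+h≤n : suc h ≤ n
      1+h≤n = 2^-<2^suc e

      0<h : 0 < h
      0<h = m^n>0 2 e

    v : Vertex d
    v = vertex (interval n h (suc h)) (length-interval h (suc h))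

    toList-v : toList v ≡ interval n h (suc h)
    toList-v = toList-vertex (interval n h (suc h)) (length-interval h (suc h))

    -- For blocks shorter than h both blocks of v vanish, so they are complemented;
    -- for blocks of length h they differ at their first position, so they are swapped.
    v-neighbours-start-with-1 : ∀ s → s ≤ d → bit (neighbour s (interval n h (suc h))) 0 ≡ true
    v-neighbours-start-with-1 zero _ = begin
      bit (flip₁ x) 0   ≡⟨ bit-flip₁-zero x (subst (1 ≤_) (sym (length-interval h (suc h))) 0<n) ⟩
      not (bit x 0)     ≡⟨ cong not (bit-interval-below h (suc h) 0<h 0<n) ⟩
      true              ∎
      where
        open ≡-Reasoning
        x = interval n h (suc h)
    v-neighbours-start-with-1 (suc s) 1+s≤d with m≤n⇒m<n∨m≡n (≤-pred 1+s≤d)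
    ... | inj₁ s<e = begin
      bit (blockOp b x) 0            ≡⟨ cong (λ z → bit z 0) (blockOp-complements b x 2b≤∣x∣
                                          (interval-SameBlocks b h (suc h) 2b≤h (2^-≤n 1+s≤d))) ⟩
      bit (complementBlocks b x) 0   ≡⟨ complemented-first b x 2b≤∣x∣ (m^n>0 2 s) ⟩
      not (bit x 0)                  ≡⟨ cong not (bit-interval-below h (suc h) 0<h 0<n) ⟩
      true                           ∎
      where
        open ≡-Reasoning
        b = 2 ^ s
        x = interval n h (suc h)
        2b≤h = ^-monoʳ-≤ 2 s<e
        2b≤∣x∣ = subst (2 * b ≤_) (sym (length-interval h (suc h))) (2^-≤n 1+s≤d)
    ... | inj₂ refl = begin
      bit (blockOp h x) 0            ≡⟨ cong (λ z → bit z 0) (blockOp-swaps h x 2h≤∣x∣ 0<h x₀≢xₕ) ⟩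
      bit (swapBlocks h x) 0         ≡⟨ swapped-first h x 2h≤∣x∣ 0<h ⟩
      bit x (h + 0)                  ≡⟨ xₕ≡true ⟩
      true                           ∎
      where
        open ≡-Reasoning
        x = interval n h (suc h)
        2h≤∣x∣ = subst (2 * h ≤_) (sym (length-interval h (suc h))) (2^-≤n 1+s≤d)
        h+0<n = <-≤-trans (s≤s (≤-reflexive (+-identityʳ h))) 1+h≤n
        xₕ≡true = bit-interval-inside h (suc h) (m≤m+n h 0) (s≤s (≤-reflexive (+-identityʳ h))) h+0<n
        x₀≢xₕ : bit x 0 ≢ bit x (h + 0)
        x₀≢xₕ eq =
          contradiction (trans (sym (bit-interval-below h (suc h) 0<h 0<n)) (trans eq xₕ≡true)) λ ()

    -- v ends at the odd number h + 1, the centres at the even numbers 2 and 2 ^ (j + 1).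
    v≢even-interval : ∀ lo a → lo < 2 * a → 2 * a ≤ n → toList v ≢ interval n lo (2 * a)
    v≢even-interval lo a lo<2a 2a≤n eq with 2^-even e 1≤e
    ... | k , h≡2k = even≢odd a k (trans (sym 1+h≡2a) (cong suc h≡2k))
      where
        1+h≡2a = proj₂ (interval-injective (n<1+n h) 1+h≤n lo<2a 2a≤n (trans (sym toList-v) eq))

    v-remains : Remaining d cutStars v
    v-remains = remains
      (B.∉-star (v≢even-interval 1 1 (s≤s ≤-refl) (2^-≤n 1≤d)) B-centre-starts-with-0 v-neighbours)
      λ t _ → W.∉-star t (v≢even-interval (2 ^ level t) (2 ^ level t) (2^-<2^suc (level t)) (2^-≤n (level<d t)))
                (W-centre-starts-with-0 (level t)) v-neighbours
      where
        v-neighbours : ∀ s → s ≤ d → bit (neighbour s (toList v)) 0 ≡ true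
        v-neighbours s s≤d =
          trans (cong (λ z → bit (neighbour s z) 0) toList-v) (v-neighbours-start-with-1 s s≤d)

    v≢u : v ≢ u
    v≢u eq =
      interval-empty≢ (n<1+n h) 1+h≤n (trans (sym toList-u) (trans (cong toList (sym eq)) toList-v))

    disconnected : Disconnected d (Remaining d cutStars)
    disconnected = u , v , u-remains , v-remains ,
      λ path → v≢u (path-from-isolated (λ adj remains → remains (neighbours-of-u-covered adj)) path)

-- For d = 1 every vertex other than u is a neighbour of u.
trivial-cut : ∀ m (2≤m : 2 ≤ m) (m≤2 : m ≤ 2) → Trivial 1 (Remaining 1 (Cut.cutStars 0 m 2≤m m≤2))
trivial-cut m 2≤m m≤2 = u , u-remains , only-u
  where
    open Cut 0 m 2≤m m≤2
    only-u : ∀ z → Remaining 1 cutStars z → z ≡ u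
    only-u (false ∷ false ∷ []) _       = refl
    only-u (true  ∷ false ∷ []) remains = contradiction (neighbours-of-u-covered (inj₁ refl)) remains
    only-u (false ∷ true  ∷ []) remains =
      contradiction (neighbours-of-u-covered (inj₂ (inj₂ refl))) remains
    only-u (true  ∷ true  ∷ []) remains =
      contradiction (neighbours-of-u-covered (inj₂ (inj₁ (1 , ≤-refl , ≤-refl , refl)))) remains

mainTheorem7 : (d : ℕ) → 1 ≤ d → (m : ℕ) → 2 ≤ m → m ≤ d + 1 →
    Σ (List (Star d m)) λ F → IsStructureCut d F × length F ≤ d / 2 + 1
mainTheorem7 (suc zero) _ m 2≤m m≤2 =
  cutStars , inj₂ (trivial-cut m 2≤m m≤2) , length-cutStars
  where open Cut 0 m 2≤m m≤2
mainTheorem7 (suc (suc e)) _ m 2≤m m≤d+1 =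
  cutStars , inj₁ (disconnected (s≤s z≤n)) , length-cutStars
  where open Cut (suc e) m 2≤m (subst (m ≤_) (+-comm (suc (suc e)) 1) m≤d+1)
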